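{- For every nonnegative integer $k$, $\Delta(6k+4,k) > 0$.
   Context: For integers $n \ge 1$ and $k \ge 0$, $JL_{n,k} = \sum_{i=k}^{\lfloor n/2 \rfloor} \frac{n}{n-i} \binom{n-i}{i} \binom{i}{k}$ (empty sum $=0$), and $\Delta(n,k) = JL_{n,k+1} - JL_{n,k}$. -}

module Defs where

open import Data.Nat using (ℕ; zero; suc; _∸_; _/_)
open import Data.Nat.Combinatorics using (_C_)
open import Data.Integer using (+_)
open import Data.Rational using (ℚ; 0ℚ; _+_; _-_; _*_) renaming (_/_ to _/ℚ_)

-- Σ_{i=a}^{b} f i  (empty, i.e. 0, when b < a)
sumFromTo : ℕ → ℕ → (ℕ → ℚ) → ℚ
sumFromTo a b f = go a (suc b ∸ a)
  where
  go : ℕ → ℕ → ℚ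
  go i zero    = 0ℚ
  go i (suc m) = f i + go (suc i) m

-- n / m as a rational number (m = 0 gives 0; never used inside the range i ≤ ⌊n/2⌋, n ≥ 1)
fracℕ : ℕ → ℕ → ℚ
fracℕ n zero    = 0ℚ
fracℕ n (suc m) = (+ n) /ℚ (suc m)

JLterm : ℕ → ℕ → ℕ → ℚ
JLterm n k i = fracℕ n (n ∸ i) * ((+ ((n ∸ i) C i)) /ℚ 1) * ((+ (i C k)) /ℚ 1)

JL : ℕ → ℕ → ℚ
JL n k = sumFromTo k (n / 2) (JLterm n k)

Δ : ℕ → ℕ → ℚ
Δ n k = JL n (suc k) - JL n k

module Submission where

-- Write n = 6k+4 and t x = JLterm n k (k + x) for 0 ≤ x ≤ 2k+2, so that JL n k = Σ t x and, by
-- absorption, (k+1)·JL n (k+1) = Σ x·t x; hence (k+1)·Δ(n,k) = Σ (x − (k+1))·t x.  The ratio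
-- t(x+1)/t x is a rational function of x and k, which allows a Gosper-type certificate: for
-- explicit polynomials M(k) > 0, h, V and Q with t(x+1)·V(x+1) = t x·h(x), V(0) = h(2k+2) = 0
-- and M·(x − (k+1)) = x·Q(x) − (h(x) − V(x)), the h- and V-parts telescope away, leaving
-- M·(k+1)·Δ(n,k) = Σ t x·x·Q(x).  As a polynomial in x, Q has positive leading coefficient and
-- negative discriminant, so every summand is ≥ 0 and the one at x = 1 is > 0.

open import Defs
open import Level using (0ℓ)
open import Data.Nat using (ℕ)
open import Algebra.Bundles.Raw using (RawRing)

module Binomial where
  open import Data.Nat
  open import Data.Nat.Properties
  open import Data.Nat.Combinatorics
  open import Relation.Binary.PropositionalEquality
  open ≡-Reasoning

  [k+1]*[n+1]C[k+1]≡[n+1]*nCk : ∀ n k → suc k * (suc n C suc k) ≡ suc n * (n C k)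
  [k+1]*[n+1]C[k+1]≡[n+1]*nCk zero    zero    = refl
  [k+1]*[n+1]C[k+1]≡[n+1]*nCk zero    (suc k)
    rewrite k>n⇒nCk≡0 {1} {2 + k} (s<s z<s) | k>n⇒nCk≡0 {0} {suc k} z<s = *-zeroʳ (2 + k)
  [k+1]*[n+1]C[k+1]≡[n+1]*nCk (suc n) zero
    rewrite nC1≡n (2 + n) = *-comm 1 (2 + n)
  [k+1]*[n+1]C[k+1]≡[n+1]*nCk (suc n) (suc k) = begin
    suc (suc k) * (suc (suc n) C suc (suc k))
      ≡⟨ cong (suc (suc k) *_) (nCk+nC[k+1]≡[n+1]C[k+1] (suc n) (suc k)) ⟨
    suc (suc k) * (A + B)
      ≡⟨ *-distribˡ-+ (suc (suc k)) A B ⟩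
    (A + suc k * A) + suc (suc k) * B
      ≡⟨ cong₂ (λ a b → (A + a) + b) ([k+1]*[n+1]C[k+1]≡[n+1]*nCk n k) ([k+1]*[n+1]C[k+1]≡[n+1]*nCk n (suc k)) ⟩
    (A + suc n * (n C k)) + suc n * (n C suc k)
      ≡⟨ +-assoc A _ _ ⟩
    A + (suc n * (n C k) + suc n * (n C suc k))
      ≡⟨ cong (A +_) (*-distribˡ-+ (suc n) (n C k) (n C suc k)) ⟨
    A + suc n * (n C k + n C suc k)
      ≡⟨ cong (λ c → A + suc n * c) (nCk+nC[k+1]≡[n+1]C[k+1] n k) ⟩
    A + suc n * A
      ∎
    where
    A B : ℕ
    A = suc n C suc k
    B = suc n C suc (suc k)

  [j+1]*[j+d]C[j+1]≡d*[j+d]Cj : ∀ j d → suc j * ((j + d) C suc j) ≡ d * ((j + d) C j)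
  [j+1]*[j+d]C[j+1]≡d*[j+d]Cj j d = +-cancelˡ-≡ (suc j * A) _ _ (begin
    suc j * A + suc j * B       ≡⟨ *-distribˡ-+ (suc j) A B ⟨
    suc j * (A + B)             ≡⟨ cong (suc j *_) (nCk+nC[k+1]≡[n+1]C[k+1] (j + d) j) ⟩
    suc j * (suc (j + d) C suc j) ≡⟨ [k+1]*[n+1]C[k+1]≡[n+1]*nCk (j + d) j ⟩
    (suc j + d) * A             ≡⟨ *-distribʳ-+ A (suc j) d ⟩
    suc j * A + d * A           ∎)
    where
    A B : ℕ
    A = (j + d) C j
    B = (j + d) C suc j

  [j+d]Cj≡[j+d]Cd : ∀ j d → (j + d) C j ≡ (j + d) C d
  [j+d]Cj≡[j+d]Cd j d = trans (nCk≡nC[n∸k] (m≤m+n j d)) (cong ((j + d) C_) (m+n∸m≡n j d))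

  [d+1]*[j+d+1]Cj≡[j+d+1]*[j+d]Cj : ∀ j d → suc d * (suc (j + d) C j) ≡ suc (j + d) * ((j + d) C j)
  [d+1]*[j+d+1]Cj≡[j+d+1]*[j+d]Cj j d = begin
    suc d * (suc (j + d) C j)     ≡⟨ cong (λ m → suc d * (m C j)) (+-suc j d) ⟨
    suc d * ((j + suc d) C j)     ≡⟨ cong (suc d *_) ([j+d]Cj≡[j+d]Cd j (suc d)) ⟩
    suc d * ((j + suc d) C suc d) ≡⟨ cong (λ m → suc d * (m C suc d)) (+-suc j d) ⟩
    suc d * (suc (j + d) C suc d) ≡⟨ [k+1]*[n+1]C[k+1]≡[n+1]*nCk (j + d) d ⟩
    suc (j + d) * ((j + d) C d)   ≡⟨ cong (suc (j + d) *_) ([j+d]Cj≡[j+d]Cd j d) ⟨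
    suc (j + d) * ((j + d) C j)   ∎

  0<nCk : ∀ {n k} → k ≤ n → 0 < n C k
  0<nCk {n}     {zero}  _         = z<s
  0<nCk {suc n} {suc k} (s≤s k≤n) =
    subst (0 <_) (nCk+nC[k+1]≡[n+1]C[k+1] n k) (<-≤-trans (0<nCk k≤n) (m≤m+n _ _))

module Embedding where
  open import Data.Nat as ℕ using (ℕ; zero; suc)
  import Data.Nat.Properties as ℕ
  open import Data.Integer as ℤ using (+_)
  import Data.Integer.Properties as ℤ
  open import Data.Rational
  open import Data.Rational.Properties
  open import Data.Rational.Unnormalised as ℚᵘ using (mkℚᵘ; *≡*)
  import Data.Rational.Unnormalised.Properties as ℚᵘ
  open import Relation.Binary.PropositionalEquality

  -- The cast ℕ → ℚ in the form used by JLterm; also ι n = fracℕ n 1 definitionally.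
  ι : ℕ → ℚ
  ι n = + n / 1

  toℚᵘ-fracℕ : ∀ n m → toℚᵘ (fracℕ n (suc m)) ℚᵘ.≃ mkℚᵘ (+ n) m
  toℚᵘ-fracℕ n m = toℚᵘ-fromℚᵘ (mkℚᵘ (+ n) m)

  ι-+ : ∀ m n → ι (m ℕ.+ n) ≡ ι m + ι n
  ι-+ m n = toℚᵘ-injective (begin
    toℚᵘ (ι (m ℕ.+ n))              ≈⟨ toℚᵘ-fracℕ (m ℕ.+ n) 0 ⟩
    mkℚᵘ (+ (m ℕ.+ n)) 0            ≈⟨ *≡* (cong (ℤ._* + 1) +[m+n]≡+m*1++n*1) ⟩
    mkℚᵘ (+ m) 0 ℚᵘ.+ mkℚᵘ (+ n) 0  ≈⟨ ℚᵘ.+-cong (toℚᵘ-fracℕ m 0) (toℚᵘ-fracℕ n 0) ⟨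
    toℚᵘ (ι m) ℚᵘ.+ toℚᵘ (ι n)      ≈⟨ toℚᵘ-homo-+ (ι m) (ι n) ⟨
    toℚᵘ (ι m + ι n)                ∎)
    where
    open ℚᵘ.≃-Reasoning
    +[m+n]≡+m*1++n*1 : + (m ℕ.+ n) ≡ + m ℤ.* + 1 ℤ.+ + n ℤ.* + 1
    +[m+n]≡+m*1++n*1 = trans (ℤ.pos-+ m n) (sym (cong₂ ℤ._+_ (ℤ.*-identityʳ (+ m)) (ℤ.*-identityʳ (+ n))))

  ι-* : ∀ m n → ι (m ℕ.* n) ≡ ι m * ι n
  ι-* m n = toℚᵘ-injective (begin
    toℚᵘ (ι (m ℕ.* n))              ≈⟨ toℚᵘ-fracℕ (m ℕ.* n) 0 ⟩
    mkℚᵘ (+ (m ℕ.* n)) 0            ≈⟨ *≡* (cong (ℤ._* + 1) (ℤ.pos-* m n)) ⟩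
    mkℚᵘ (+ m) 0 ℚᵘ.* mkℚᵘ (+ n) 0  ≈⟨ ℚᵘ.*-cong (toℚᵘ-fracℕ m 0) (toℚᵘ-fracℕ n 0) ⟨
    toℚᵘ (ι m) ℚᵘ.* toℚᵘ (ι n)      ≈⟨ toℚᵘ-homo-* (ι m) (ι n) ⟨
    toℚᵘ (ι m * ι n)                ∎)
    where open ℚᵘ.≃-Reasoning

  fracℕ-*-ι : ∀ n m → fracℕ n (suc m) * ι (suc m) ≡ ι n
  fracℕ-*-ι n m = toℚᵘ-injective (begin
    toℚᵘ (fracℕ n (suc m) * ι (suc m))           ≈⟨ toℚᵘ-homo-* (fracℕ n (suc m)) (ι (suc m)) ⟩
    toℚᵘ (fracℕ n (suc m)) ℚᵘ.* toℚᵘ (ι (suc m)) ≈⟨ ℚᵘ.*-cong (toℚᵘ-fracℕ n m) (toℚᵘ-fracℕ (suc m) 0) ⟩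
    mkℚᵘ (+ n) m ℚᵘ.* mkℚᵘ (+ suc m) 0           ≈⟨ *≡* n*[m+1]≡n*[m*1+1] ⟩
    mkℚᵘ (+ n) 0                                 ≈⟨ toℚᵘ-fracℕ n 0 ⟨
    toℚᵘ (ι n)                                   ∎)
    where
    open ℚᵘ.≃-Reasoning
    n*[m+1]≡n*[m*1+1] : (+ n ℤ.* + suc m) ℤ.* + 1 ≡ + n ℤ.* + suc (m ℕ.* 1)
    n*[m+1]≡n*[m*1+1] = trans (ℤ.*-identityʳ _) (cong (λ d → + n ℤ.* + suc d) (sym (ℕ.*-identityʳ m)))

  fracℕ-*-ι-* : ∀ n m p → fracℕ n (suc m) * ι (suc m ℕ.* p) ≡ ι (n ℕ.* p)
  fracℕ-*-ι-* n m p = begin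
    fracℕ n (suc m) * ι (suc m ℕ.* p)       ≡⟨ cong (fracℕ n (suc m) *_) (ι-* (suc m) p) ⟩
    fracℕ n (suc m) * (ι (suc m) * ι p)     ≡⟨ *-assoc (fracℕ n (suc m)) (ι (suc m)) (ι p) ⟨
    fracℕ n (suc m) * ι (suc m) * ι p       ≡⟨ cong (_* ι p) (fracℕ-*-ι n m) ⟩
    ι n * ι p                               ≡⟨ ι-* n p ⟨
    ι (n ℕ.* p)                             ∎
    where open ≡-Reasoning

  fracℕ-nonNeg : ∀ n m → 0ℚ ≤ fracℕ n m
  fracℕ-nonNeg n zero    = ≤-refl
  fracℕ-nonNeg n (suc m) = nonNegative⁻¹ _ {{normalize-nonNeg n (suc m)}}

  fracℕ-pos : ∀ {n m} → 0 ℕ.< n → 0 ℕ.< m → 0ℚ < fracℕ n m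
  fracℕ-pos {suc n} {suc m} _ _ = positive⁻¹ _ {{normalize-pos (suc n) (suc m)}}

  ι-nonNeg : ∀ n → 0ℚ ≤ ι n
  ι-nonNeg n = fracℕ-nonNeg n 1

  ι-pos : ∀ {n} → 0 ℕ.< n → 0ℚ < ι n
  ι-pos 0<n = fracℕ-pos 0<n ℕ.z<s

module Order where
  import Data.Nat as ℕ
  open import Data.Sum using (inj₁; inj₂)
  open import Data.Rational
  open import Data.Rational.Properties
  open import Data.Rational.Solver using (module +-*-Solver)
  open import Relation.Binary.PropositionalEquality
  open Embedding

  private variable p q : ℚ

  *-nonNeg : 0ℚ ≤ p → 0ℚ ≤ q → 0ℚ ≤ p * q
  *-nonNeg {p} {q} 0≤p 0≤q = nonNegative⁻¹ _ {{nonNeg*nonNeg⇒nonNeg p {{nonNegative 0≤p}} q {{nonNegative 0≤q}}}}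

  *-pos : 0ℚ < p → 0ℚ < q → 0ℚ < p * q
  *-pos {p} {q} 0<p 0<q = positive⁻¹ _ {{pos*pos⇒pos p {{positive 0<p}} q {{positive 0<q}}}}

  *-cancelˡ-pos : 0ℚ < p → 0ℚ < p * q → 0ℚ < q
  *-cancelˡ-pos {p} {q} 0<p 0<pq =
    *-cancelˡ-<-nonNeg p {{nonNegative (<⇒≤ 0<p)}} (subst (_< p * q) (sym (*-zeroʳ p)) 0<pq)

  square-nonNeg : ∀ p → 0ℚ ≤ p * p
  square-nonNeg p with ≤-total 0ℚ p
  ... | inj₁ 0≤p = *-nonNeg 0≤p 0≤p
  ... | inj₂ p≤0 = nonNegative⁻¹ _ {{nonPos*nonPos⇒nonPos p {{nonPositive p≤0}} p {{nonPositive p≤0}}}}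

  quadratic-pos : ∀ {a b c} x → 0ℚ < a → 0ℚ < ι 4 * a * c - b * b → 0ℚ < a * x * x + b * x + c
  quadratic-pos {a} {b} {c} x 0<a 0<disc = *-cancelˡ-pos (*-pos (ι-pos {4} ℕ.z<s) 0<a)
    (subst (0ℚ <_) (sym (complete-square a b c x)) (+-mono-≤-< (square-nonNeg (ι 2 * a * x + b)) 0<disc))
    where
    complete-square : ∀ a b c x → ι 4 * a * (a * x * x + b * x + c) ≡ (ι 2 * a * x + b) * (ι 2 * a * x + b) + (ι 4 * a * c - b * b)
    complete-square = solve 4 (λ a b c x → con (ι 4) :* a :* (a :* x :* x :+ b :* x :+ c)
                                         := (con (ι 2) :* a :* x :+ b) :* (con (ι 2) :* a :* x :+ b) :+ (con (ι 4) :* a :* c :- b :* b)) refl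
      where open +-*-Solver

module Summation where
  open import Data.Nat as ℕ using (ℕ; zero; suc)
  import Data.Nat.Properties as ℕ
  open import Data.Fin using (zero; suc; toℕ; inject₁; fromℕ; punchIn)
  open import Data.Fin.Properties using (toℕ-inject₁; toℕ-fromℕ; toℕ<n)
  open import Data.Vec.Functional using (Vector; removeAt)
  open import Function using (_∘_)
  open import Data.Rational
  open import Data.Rational.Properties
  open import Algebra.Bundles using (Ring)
  open import Relation.Binary.PropositionalEquality
  open ≡-Reasoning
  open import Algebra.Properties.Semiring.Sum (Ring.semiring +-*-ring) public

  sumFromTo-unfold : ∀ {a b} (f : ℕ → ℚ) → a ℕ.≤ b → sumFromTo a b f ≡ f a + sumFromTo (suc a) b f
  sumFromTo-unfold f a≤b rewrite ℕ.+-∸-assoc 1 a≤b = refl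

  sumFromTo-empty : ∀ {a b} (f : ℕ → ℚ) → b ℕ.< a → sumFromTo a b f ≡ 0ℚ
  sumFromTo-empty f b<a rewrite ℕ.m≤n⇒m∸n≡0 b<a = refl

  sumFromTo-∑ : ∀ a m (f : ℕ → ℚ) → sumFromTo a (a ℕ.+ m) f ≡ ∑[ i ≤ m ] f (a ℕ.+ toℕ i)
  sumFromTo-∑ a zero f = begin
    sumFromTo a (a ℕ.+ 0) f                 ≡⟨ sumFromTo-unfold f (ℕ.m≤m+n a 0) ⟩
    f a + sumFromTo (suc a) (a ℕ.+ 0) f     ≡⟨ cong₂ _+_ (cong f (sym (ℕ.+-identityʳ a))) (sumFromTo-empty f a+0<1+a) ⟩
    f (a ℕ.+ 0) + 0ℚ                        ∎
    where
    a+0<1+a : a ℕ.+ 0 ℕ.< suc a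
    a+0<1+a = ℕ.s≤s (ℕ.≤-reflexive (ℕ.+-identityʳ a))
  sumFromTo-∑ a (suc m) f = begin
    sumFromTo a (a ℕ.+ suc m) f             ≡⟨ sumFromTo-unfold f (ℕ.m≤m+n a (suc m)) ⟩
    f a + sumFromTo (suc a) (a ℕ.+ suc m) f ≡⟨ cong₂ _+_ (cong f (sym (ℕ.+-identityʳ a))) (cong (λ b → sumFromTo (suc a) b f) (ℕ.+-suc a m)) ⟩
    f (a ℕ.+ 0) + sumFromTo (suc a) (suc a ℕ.+ m) f
                                            ≡⟨ cong (f (a ℕ.+ 0) +_) (sumFromTo-∑ (suc a) m f) ⟩
    f (a ℕ.+ 0) + ∑[ i ≤ m ] f (suc a ℕ.+ toℕ i)
                                            ≡⟨ cong (f (a ℕ.+ 0) +_) (sum-cong-≗ {suc m} (λ i → cong f (ℕ.+-suc a (toℕ i)))) ⟨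
    ∑[ i ≤ suc m ] f (a ℕ.+ toℕ i)          ∎

  ∑-neg : ∀ {m} (f : Vector ℚ m) → ∑[ i < m ] (- f i) ≡ - sum f
  ∑-neg {zero}  f = refl
  ∑-neg {suc m} f = trans (cong (- f zero +_) (∑-neg (f ∘ suc))) (sym (neg-distrib-+ (f zero) _))

  ∑-distrib-- : ∀ {m} (f g : Vector ℚ m) → ∑[ i < m ] (f i - g i) ≡ sum f - sum g
  ∑-distrib-- f g = trans (∑-distrib-+ f (λ i → - g i)) (cong (sum f +_) (∑-neg g))

  ∑-shift : ∀ m (f g : ℕ → ℚ) → f 0 ≡ 0ℚ → g m ≡ 0ℚ → (∀ x → x ℕ.< m → g x ≡ f (suc x)) →
            ∑[ i ≤ m ] g (toℕ i) ≡ ∑[ i ≤ m ] f (toℕ i)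
  ∑-shift m f g f0≡0 gm≡0 g≡f∘suc = begin
    ∑[ i ≤ m ] g (toℕ i)                                ≡⟨ sum-init-last {m} (g ∘ toℕ) ⟩
    ∑[ i < m ] g (toℕ (inject₁ i)) + g (toℕ (fromℕ m))  ≡⟨ cong₂ _+_ (sum-cong-≗ shift) (trans (cong g (toℕ-fromℕ m)) gm≡0) ⟩
    ∑[ i < m ] f (suc (toℕ i)) + 0ℚ                     ≡⟨ +-identityʳ _ ⟩
    ∑[ i < m ] f (suc (toℕ i))                          ≡⟨ +-identityˡ _ ⟨
    0ℚ + ∑[ i < m ] f (suc (toℕ i))                     ≡⟨ cong (_+ ∑[ i < m ] f (suc (toℕ i))) f0≡0 ⟨
    ∑[ i ≤ m ] f (toℕ i)                                ∎
    where
    shift : ∀ i → g (toℕ (inject₁ i)) ≡ f (suc (toℕ i))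
    shift i = trans (cong g (toℕ-inject₁ i)) (g≡f∘suc (toℕ i) (toℕ<n i))

  ∑-nonNeg : ∀ {m} (f : Vector ℚ m) → (∀ i → 0ℚ ≤ f i) → 0ℚ ≤ sum f
  ∑-nonNeg {zero}  f _   = ≤-refl
  ∑-nonNeg {suc m} f 0≤f = +-mono-≤ (0≤f zero) (∑-nonNeg (f ∘ suc) (0≤f ∘ suc))

  ∑-pos : ∀ {m} (f : Vector ℚ (suc m)) → (∀ i → 0ℚ ≤ f i) → ∀ j → 0ℚ < f j → 0ℚ < sum f
  ∑-pos f 0≤f j 0<fj =
    subst (0ℚ <_) (sym (sum-remove f)) (+-mono-<-≤ 0<fj (∑-nonNeg (removeAt f j) (0≤f ∘ punchIn j)))

module JacobsthalLucas where
  open import Data.Nat as ℕ using (ℕ; suc; _∸_)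
  import Data.Nat.Properties as ℕ
  open import Data.Nat.Combinatorics using (_C_; k>n⇒nCk≡0)
  open import Data.Fin using (toℕ)
  open import Algebra.Definitions.RawMagma ℕ.+-rawMagma using (_,_)
  open import Data.Rational
  open import Data.Rational.Properties
  open import Data.Rational.Solver using (module +-*-Solver)
  open import Data.Nat.Tactic.RingSolver using (solve-∀)
  open import Algebra.Bundles using (CommutativeMonoid)
  open import Algebra.Properties.CommutativeSemigroup (CommutativeMonoid.commutativeSemigroup *-1-commutativeMonoid)
    using (x∙yz≈y∙xz)
  open import Relation.Binary.PropositionalEquality
  open ≡-Reasoning
  open Binomial
  open Embedding
  open Order
  open Summation

  JLterm-nonNeg : ∀ n k i → 0ℚ ≤ JLterm n k i
  JLterm-nonNeg n k i = *-nonNeg (*-nonNeg (fracℕ-nonNeg n (n ∸ i)) (ι-nonNeg ((n ∸ i) C i))) (ι-nonNeg (i C k))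

  JLterm-pos : ∀ {n k i} → k ℕ.≤ i → i ℕ.+ i ℕ.< n → 0ℚ < JLterm n k i
  JLterm-pos {n} {k} {i} k≤i 2i<n =
    *-pos (*-pos (fracℕ-pos 0<n (ℕ.m<n⇒0<n∸m i<n)) (ι-pos (0<nCk i≤n∸i))) (ι-pos (0<nCk k≤i))
    where
    i≤n∸i : i ℕ.≤ n ∸ i
    i≤n∸i = ℕ.m+n≤o⇒m≤o∸n i (ℕ.<⇒≤ 2i<n)
    i<n : i ℕ.< n
    i<n = ℕ.≤-<-trans (ℕ.m≤m+n i i) 2i<n
    0<n : 0 ℕ.< n
    0<n = ℕ.≤-<-trans ℕ.z≤n i<n

  JLterm-*-ι : ∀ n k i m {N} → n ∸ i ≡ N → JLterm n k i * ι m ≡ fracℕ n N * ι ((N C i) ℕ.* ((i C k) ℕ.* m))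
  JLterm-*-ι n k i m {N} refl = begin
    f * ι (N C i) * ι (i C k) * ι m
      ≡⟨ trans (*-assoc (f * ι (N C i)) (ι (i C k)) (ι m)) (*-assoc f (ι (N C i)) (ι (i C k) * ι m)) ⟩
    f * (ι (N C i) * (ι (i C k) * ι m))
      ≡⟨ cong (λ x → f * (ι (N C i) * x)) (ι-* (i C k) m) ⟨
    f * (ι (N C i) * ι ((i C k) ℕ.* m))
      ≡⟨ cong (f *_) (ι-* (N C i) ((i C k) ℕ.* m)) ⟨
    f * ι ((N C i) ℕ.* ((i C k) ℕ.* m))
      ∎
    where
    f : ℚ
    f = fracℕ n N

  JLterm[n,k+1,k]≡0 : ∀ n k → JLterm n (suc k) k ≡ 0ℚ
  JLterm[n,k+1,k]≡0 n k = trans (cong (λ c → fracℕ n (n ∸ k) * ι ((n ∸ k) C k) * ι c) (k>n⇒nCk≡0 (ℕ.n<1+n k)))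
                              (*-zeroʳ (fracℕ n (n ∸ k) * ι ((n ∸ k) C k)))

  [k+1]*JLterm[k+1]≡x*JLterm : ∀ n k x → ι (suc k) * JLterm n (suc k) (k ℕ.+ x) ≡ ι x * JLterm n k (k ℕ.+ x)
  [k+1]*JLterm[k+1]≡x*JLterm n k x = begin
    ι (suc k) * (F * ι (i C suc k)) ≡⟨ x∙yz≈y∙xz (ι (suc k)) F _ ⟩
    F * (ι (suc k) * ι (i C suc k)) ≡⟨ cong (F *_) (trans (sym (ι-* (suc k) (i C suc k))) (cong ι ([j+1]*[j+d]C[j+1]≡d*[j+d]Cj k x))) ⟩
    F * ι (x ℕ.* (i C k))           ≡⟨ cong (F *_) (ι-* x (i C k)) ⟩
    F * (ι x * ι (i C k))           ≡⟨ x∙yz≈y∙xz F (ι x) _ ⟩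
    ι x * (F * ι (i C k))           ∎
    where
    i : ℕ
    i = k ℕ.+ x
    F : ℚ
    F = fracℕ n (n ∸ i) * ι ((n ∸ i) C i)

  JL≡∑ : ∀ n k m → n ℕ./ 2 ≡ k ℕ.+ m → JL n k ≡ ∑[ x ≤ m ] JLterm n k (k ℕ.+ toℕ x)
  JL≡∑ n k m n/2≡k+m = trans (cong (λ b → sumFromTo k b (JLterm n k)) n/2≡k+m) (sumFromTo-∑ k m (JLterm n k))

  [k+1]*JL[k+1]≡∑ : ∀ n k m → n ℕ./ 2 ≡ k ℕ.+ m →
                    ι (suc k) * JL n (suc k) ≡ ∑[ x ≤ m ] (ι (toℕ x) * JLterm n k (k ℕ.+ toℕ x))
  [k+1]*JL[k+1]≡∑ n k m n/2≡k+m = begin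
    ι (suc k) * sumFromTo (suc k) (n ℕ./ 2) F
      ≡⟨ cong (ι (suc k) *_) sumFromTo[k+1]≡sumFromTo[k] ⟩
    ι (suc k) * sumFromTo k (k ℕ.+ m) F
      ≡⟨ cong (ι (suc k) *_) (sumFromTo-∑ k m F) ⟩
    ι (suc k) * ∑[ x ≤ m ] F (k ℕ.+ toℕ x)
      ≡⟨ *-distribˡ-sum {suc m} (ι (suc k)) (λ x → F (k ℕ.+ toℕ x)) ⟩
    ∑[ x ≤ m ] (ι (suc k) * F (k ℕ.+ toℕ x))
      ≡⟨ sum-cong-≗ {suc m} (λ x → [k+1]*JLterm[k+1]≡x*JLterm n k (toℕ x)) ⟩
    ∑[ x ≤ m ] (ι (toℕ x) * JLterm n k (k ℕ.+ toℕ x))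
      ∎
    where
    F : ℕ → ℚ
    F = JLterm n (suc k)
    sumFromTo[k+1]≡sumFromTo[k] : sumFromTo (suc k) (n ℕ./ 2) F ≡ sumFromTo k (k ℕ.+ m) F
    sumFromTo[k+1]≡sumFromTo[k] = begin
      sumFromTo (suc k) (n ℕ./ 2) F        ≡⟨ +-identityˡ (sumFromTo (suc k) (n ℕ./ 2) F) ⟨
      0ℚ + sumFromTo (suc k) (n ℕ./ 2) F   ≡⟨ cong (_+ sumFromTo (suc k) (n ℕ./ 2) F) (JLterm[n,k+1,k]≡0 n k) ⟨
      F k + sumFromTo (suc k) (n ℕ./ 2) F  ≡⟨ sumFromTo-unfold F k≤n/2 ⟨
      sumFromTo k (n ℕ./ 2) F              ≡⟨ cong (λ b → sumFromTo k b F) n/2≡k+m ⟩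
      sumFromTo k (k ℕ.+ m) F              ∎
      where
      k≤n/2 : k ℕ.≤ n ℕ./ 2
      k≤n/2 = subst (k ℕ.≤_) (sym n/2≡k+m) (ℕ.m≤m+n k m)

  module _ (k d e : ℕ) where
    private
      i n N₁ R : ℕ
      i  = k ℕ.+ d
      n  = 2 ℕ.* suc i ℕ.+ e
      N₁ = suc (i ℕ.+ e)
      R  = suc e ℕ.* (N₁ C i) ℕ.* (i C k)

      n∸[i+1]≡N₁ : n ∸ suc i ≡ N₁
      n∸[i+1]≡N₁ = trans (cong (_∸ suc i) (shape i e)) (ℕ.m+n∸m≡n (suc i) N₁)
        where
        shape : ∀ i e → 2 ℕ.* suc i ℕ.+ e ≡ suc i ℕ.+ suc (i ℕ.+ e)
        shape = solve-∀

      n∸i≡N : n ∸ i ≡ suc N₁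
      n∸i≡N = trans (cong (_∸ i) (shape i e)) (ℕ.m+n∸m≡n i (suc N₁))
        where
        shape : ∀ i e → 2 ℕ.* suc i ℕ.+ e ≡ i ℕ.+ suc (suc (i ℕ.+ e))
        shape = solve-∀

      [i+1]*N₁C[i+1]≡[e+1]*N₁Ci : suc i ℕ.* (N₁ C suc i) ≡ suc e ℕ.* (N₁ C i)
      [i+1]*N₁C[i+1]≡[e+1]*N₁Ci = subst (λ m → suc i ℕ.* (m C suc i) ≡ suc e ℕ.* (m C i)) (ℕ.+-suc i e)
                                        ([j+1]*[j+d]C[j+1]≡d*[j+d]Cj i (suc e))

      [e+2]*NCi≡N*N₁Ci : suc (suc e) ℕ.* (suc N₁ C i) ≡ suc N₁ ℕ.* (N₁ C i)
      [e+2]*NCi≡N*N₁Ci = subst (λ m → suc (suc e) ℕ.* (suc m C i) ≡ suc m ℕ.* (m C i)) (ℕ.+-suc i e)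
                               ([d+1]*[j+d+1]Cj≡[j+d+1]*[j+d]Cj i (suc e))

      left : (N₁ C suc i) ℕ.* ((suc i C k) ℕ.* (N₁ ℕ.* suc d)) ≡ N₁ ℕ.* R
      left = begin
        A ℕ.* (B ℕ.* (N₁ ℕ.* suc d))        ≡⟨ pull A B N₁ (suc d) ⟩
        N₁ ℕ.* (A ℕ.* (suc d ℕ.* B))        ≡⟨ cong (λ x → N₁ ℕ.* (A ℕ.* x)) ([d+1]*[j+d+1]Cj≡[j+d+1]*[j+d]Cj k d) ⟩
        N₁ ℕ.* (A ℕ.* (suc i ℕ.* (i C k)))  ≡⟨ cong (N₁ ℕ.*_) (ℕ.*-assoc A (suc i) (i C k)) ⟨
        N₁ ℕ.* (A ℕ.* suc i ℕ.* (i C k))    ≡⟨ cong (λ x → N₁ ℕ.* (x ℕ.* (i C k))) (ℕ.*-comm A (suc i)) ⟩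
        N₁ ℕ.* (suc i ℕ.* A ℕ.* (i C k))    ≡⟨ cong (λ x → N₁ ℕ.* (x ℕ.* (i C k))) [i+1]*N₁C[i+1]≡[e+1]*N₁Ci ⟩
        N₁ ℕ.* R                            ∎
        where
        A B : ℕ
        A = N₁ C suc i
        B = suc i C k
        pull : ∀ a b c d → a ℕ.* (b ℕ.* (c ℕ.* d)) ≡ c ℕ.* (a ℕ.* (d ℕ.* b))
        pull = solve-∀

      right : (suc N₁ C i) ℕ.* ((i C k) ℕ.* (suc (suc e) ℕ.* suc e)) ≡ suc N₁ ℕ.* R
      right = begin
        A ℕ.* (B ℕ.* (suc (suc e) ℕ.* suc e))  ≡⟨ pull A B (suc (suc e)) (suc e) ⟩
        suc (suc e) ℕ.* A ℕ.* (suc e ℕ.* B)    ≡⟨ cong (ℕ._* (suc e ℕ.* B)) [e+2]*NCi≡N*N₁Ci ⟩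
        suc N₁ ℕ.* (N₁ C i) ℕ.* (suc e ℕ.* B)  ≡⟨ push (suc N₁) (N₁ C i) (suc e) B ⟩
        suc N₁ ℕ.* R                           ∎
        where
        A B : ℕ
        A = suc N₁ C i
        B = i C k
        pull : ∀ a b c d → a ℕ.* (b ℕ.* (c ℕ.* d)) ≡ c ℕ.* a ℕ.* (d ℕ.* b)
        pull = solve-∀
        push : ∀ a b c d → a ℕ.* b ℕ.* (c ℕ.* d) ≡ a ℕ.* (c ℕ.* b ℕ.* d)
        push = solve-∀

      ι-i : ι i ≡ ι k + ι d
      ι-i = ι-+ k d

      ι-n : ι n ≡ ι 2 * (ι 1 + (ι k + ι d)) + ι e
      ι-n = trans (ι-+ (2 ℕ.* suc i) e)
                  (cong (_+ ι e) (trans (ι-* 2 (suc i)) (cong (ι 2 *_) (trans (ι-+ 1 i) (cong (ι 1 +_) ι-i)))))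

      lhs-factor : (ι n - ι i - ι 1) * (ι i + ι 1 - ι k) ≡ ι (N₁ ℕ.* suc d)
      lhs-factor = begin
        (ι n - ι i - ι 1) * (ι i + ι 1 - ι k)
          ≡⟨ cong₂ (λ a b → (a - b - ι 1) * (b + ι 1 - ι k)) ι-n ι-i ⟩
        (ι 2 * (ι 1 + (K + D)) + E - (K + D) - ι 1) * (K + D + ι 1 - K)
          ≡⟨ solve 3 (λ K D E → (con (ι 2) :* (con (ι 1) :+ (K :+ D)) :+ E :- (K :+ D) :- con (ι 1)) :* (K :+ D :+ con (ι 1) :- K)
                             := (con (ι 1) :+ (K :+ D :+ E)) :* (con (ι 1) :+ D)) refl K D E ⟩
        (ι 1 + (K + D + E)) * (ι 1 + D)
          ≡⟨ cong₂ _*_ (cong (ι 1 +_) (trans (ι-+ i e) (cong (_+ E) ι-i))) (ι-+ 1 d) ⟨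
        (ι 1 + ι (i ℕ.+ e)) * ι (suc d)
          ≡⟨ cong₂ _*_ (ι-+ 1 (i ℕ.+ e)) refl ⟨
        ι N₁ * ι (suc d)
          ≡⟨ ι-* N₁ (suc d) ⟨
        ι (N₁ ℕ.* suc d)
          ∎
        where
        open +-*-Solver
        K D E : ℚ
        K = ι k
        D = ι d
        E = ι e

      rhs-factor : (ι n - ι 2 * ι i) * (ι n - ι 2 * ι i - ι 1) ≡ ι (suc (suc e) ℕ.* suc e)
      rhs-factor = begin
        (ι n - ι 2 * ι i) * (ι n - ι 2 * ι i - ι 1)
          ≡⟨ cong₂ (λ a b → (a - ι 2 * b) * (a - ι 2 * b - ι 1)) ι-n ι-i ⟩
        (ι 2 * (ι 1 + (K + D)) + E - ι 2 * (K + D)) * (ι 2 * (ι 1 + (K + D)) + E - ι 2 * (K + D) - ι 1)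
          ≡⟨ solve 3 (λ K D E → (con (ι 2) :* (con (ι 1) :+ (K :+ D)) :+ E :- con (ι 2) :* (K :+ D))
                                :* (con (ι 2) :* (con (ι 1) :+ (K :+ D)) :+ E :- con (ι 2) :* (K :+ D) :- con (ι 1))
                             := (con (ι 2) :+ E) :* (con (ι 1) :+ E)) refl K D E ⟩
        (ι 2 + E) * (ι 1 + E)
          ≡⟨ cong₂ _*_ (ι-+ 2 e) (ι-+ 1 e) ⟨
        ι (suc (suc e)) * ι (suc e)
          ≡⟨ ι-* (suc (suc e)) (suc e) ⟨
        ι (suc (suc e) ℕ.* suc e)
          ∎
        where
        open +-*-Solver
        K D E : ℚ
        K = ι k
        D = ι d
        E = ι e

    JLterm-ratio-core : JLterm n k (suc i) * ((ι n - ι i - ι 1) * (ι i + ι 1 - ι k))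
                      ≡ JLterm n k i * ((ι n - ι 2 * ι i) * (ι n - ι 2 * ι i - ι 1))
    JLterm-ratio-core = begin
      JLterm n k (suc i) * ((ι n - ι i - ι 1) * (ι i + ι 1 - ι k))
        ≡⟨ cong (JLterm n k (suc i) *_) lhs-factor ⟩
      JLterm n k (suc i) * ι (N₁ ℕ.* suc d)
        ≡⟨ JLterm-*-ι n k (suc i) (N₁ ℕ.* suc d) n∸[i+1]≡N₁ ⟩
      fracℕ n N₁ * ι ((N₁ C suc i) ℕ.* ((suc i C k) ℕ.* (N₁ ℕ.* suc d)))
        ≡⟨ cong (λ x → fracℕ n N₁ * ι x) left ⟩
      fracℕ n N₁ * ι (N₁ ℕ.* R)
        ≡⟨ fracℕ-*-ι-* n (i ℕ.+ e) R ⟩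
      ι (n ℕ.* R)
        ≡⟨ fracℕ-*-ι-* n N₁ R ⟨
      fracℕ n (suc N₁) * ι (suc N₁ ℕ.* R)
        ≡⟨ cong (λ x → fracℕ n (suc N₁) * ι x) right ⟨
      fracℕ n (suc N₁) * ι ((suc N₁ C i) ℕ.* ((i C k) ℕ.* (suc (suc e) ℕ.* suc e)))
        ≡⟨ JLterm-*-ι n k i (suc (suc e) ℕ.* suc e) n∸i≡N ⟨
      JLterm n k i * ι (suc (suc e) ℕ.* suc e)
        ≡⟨ cong (JLterm n k i *_) rhs-factor ⟨
      JLterm n k i * ((ι n - ι 2 * ι i) * (ι n - ι 2 * ι i - ι 1))
        ∎

  JLterm-ratio : ∀ n k i → k ℕ.≤ i → 2 ℕ.* suc i ℕ.≤ n →
                 JLterm n k (suc i) * ((ι n - ι i - ι 1) * (ι i + ι 1 - ι k))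
                 ≡ JLterm n k i * ((ι n - ι 2 * ι i) * (ι n - ι 2 * ι i - ι 1))
  JLterm-ratio n k i k≤i 2[i+1]≤n with ℕ.≤⇒≤″ k≤i | ℕ.≤⇒≤″ 2[i+1]≤n
  ... | d , refl | e , refl = JLterm-ratio-core k d e

-- Generic in the ring operations, so that the same polynomials can be handed to the ring solver as syntax.
module CertificatePolynomials (R : RawRing 0ℓ 0ℓ) (c : ℕ → RawRing.Carrier R) where
  open RawRing R

  infixl 6 _-_
  _-_ : Carrier → Carrier → Carrier
  x - y = x + - y

  G M q₂ q₁ q₀ disc : Carrier → Carrier
  G K    = c 41 + K * (c 138 + c 121 * K)
  M K    = (c 12 + c 16 * K) * G K
  q₂ K   = c 175 + c 275 * K
  q₁ K   = - (c 460 + c 1090 * K + c 550 * (K * K))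
  q₀ K   = c 314 + c 1002 * K + c 959 * (K * K) + c 275 * (K * (K * K))
  disc K = c 8200 + K * (c 44000 + K * (c 79400 + K * c 48400))

  U h V Q : Carrier → Carrier → Carrier
  U K X = (c 35 + c 55 * K) * X + G K
  h K X = (c 4 * K + c 4 - c 2 * X) * (c 4 * K + c 3 - c 2 * X) * U K X
  V K X = (c 5 * K + c 4 - X) * X * U K (X - c 1)
  Q K X = q₂ K * X * X + q₁ K * X + q₀ K

module Certificate where
  import Data.Nat as ℕ
  open import Data.Rational
  open import Data.Rational.Properties using (+-mono-<-≤; +-mono-≤)
  open import Data.Rational.Solver using (module +-*-Solver)
  open import Relation.Binary.PropositionalEquality
  open +-*-Solver
  open Embedding
  open Order
  open CertificatePolynomials +-*-rawRing ι public using (G; M; q₂; q₁; q₀; disc; U; h; V; Q)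

  private
    polynomialRawRing : ℕ → RawRing 0ℓ 0ℓ
    polynomialRawRing m = record
      { Carrier = Polynomial m ; _≈_ = _≡_ ; _+_ = _:+_ ; _*_ = _:*_ ; -_ = :-_ ; 0# = con 0ℚ ; 1# = con 1ℚ }

    module S {m} = CertificatePolynomials (polynomialRawRing m) (λ j → con (ι j))

  M-certificate : ∀ K X → M K * (X - (ι 1 + K)) ≡ X * Q K X - (h K X - V K X)
  M-certificate = solve 2 (λ K X → S.M K :* (X :- (con (ι 1) :+ K)) := X :* S.Q K X :- (S.h K X :- S.V K X)) refl

  V-step : ∀ K X → V K (ι 1 + X) ≡ ((ι 6 * K + ι 4) - (K + X) - ι 1) * (K + X + ι 1 - K) * U K X
  V-step = solve 2 (λ K X → S.V K (con (ι 1) :+ X)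
                         := ((con (ι 6) :* K :+ con (ι 4)) :- (K :+ X) :- con (ι 1)) :* (K :+ X :+ con (ι 1) :- K) :* S.U K X) refl

  h-step : ∀ K X → h K X ≡ ((ι 6 * K + ι 4) - ι 2 * (K + X)) * ((ι 6 * K + ι 4) - ι 2 * (K + X) - ι 1) * U K X
  h-step = solve 2 (λ K X → S.h K X
                         := ((con (ι 6) :* K :+ con (ι 4)) :- con (ι 2) :* (K :+ X))
                            :* ((con (ι 6) :* K :+ con (ι 4)) :- con (ι 2) :* (K :+ X) :- con (ι 1)) :* S.U K X) refl

  h-root : ∀ K → h K (ι 2 + ι 2 * K) ≡ 0ℚ
  h-root = solve 1 (λ K → S.h K (con (ι 2) :+ con (ι 2) :* K) := con 0ℚ) refl

  V-root : ∀ K → V K 0ℚ ≡ 0ℚ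
  V-root = solve 1 (λ K → S.V K (con 0ℚ) := con 0ℚ) refl

  discriminant : ∀ K → ι 4 * q₂ K * q₀ K - q₁ K * q₁ K ≡ disc K
  discriminant = solve 1 (λ K → con (ι 4) :* S.q₂ K :* S.q₀ K :- S.q₁ K :* S.q₁ K := S.disc K) refl

  M-pos : ∀ {K} → 0ℚ ≤ K → 0ℚ < M K
  M-pos {K} K≥0 = *-pos (+-mono-<-≤ (ι-pos {12} ℕ.z<s) (*-nonNeg (ι-nonNeg 16) K≥0)) G-pos
    where
    G-pos : 0ℚ < G K
    G-pos = +-mono-<-≤ (ι-pos {41} ℕ.z<s) (*-nonNeg K≥0 (+-mono-≤ (ι-nonNeg 138) (*-nonNeg (ι-nonNeg 121) K≥0)))

  Q-pos : ∀ {K} → 0ℚ ≤ K → ∀ X → 0ℚ < Q K X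
  Q-pos {K} K≥0 X = quadratic-pos {q₂ K} {q₁ K} {q₀ K} X q₂-pos (subst (0ℚ <_) (sym (discriminant K)) disc-pos)
    where
    q₂-pos : 0ℚ < q₂ K
    q₂-pos = +-mono-<-≤ (ι-pos {175} ℕ.z<s) (*-nonNeg (ι-nonNeg 275) K≥0)
    disc-pos : 0ℚ < disc K
    disc-pos = +-mono-<-≤ (ι-pos {8200} ℕ.z<s) (*-nonNeg K≥0 (+-mono-≤ (ι-nonNeg 44000)
                 (*-nonNeg K≥0 (+-mono-≤ (ι-nonNeg 79400) (*-nonNeg K≥0 (ι-nonNeg 48400))))))

module SixKPlusFour (k : ℕ) where
  open import Data.Nat as ℕ using (suc)
  import Data.Nat.Properties as ℕ
  open import Data.Nat.DivMod using (m*n/n≡m)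
  open import Data.Nat.Tactic.RingSolver using (solve-∀)
  open import Data.Fin as Fin using (toℕ)
  open import Data.Rational
  open import Data.Rational.Properties
  open import Data.Rational.Solver using (module +-*-Solver)
  open import Relation.Binary.PropositionalEquality
  open ≡-Reasoning
  open Embedding
  open Order
  open Summation
  open JacobsthalLucas
  open Certificate

  n L : ℕ
  n = 6 ℕ.* k ℕ.+ 4
  L = 2 ℕ.+ 2 ℕ.* k

  K : ℚ
  K = ι k

  t δ th tV w : ℕ → ℚ
  t x  = JLterm n k (k ℕ.+ x)
  δ x  = ι x * t x - ι (suc k) * t x
  th x = t x * h K (ι x)
  tV x = t x * V K (ι x)
  w x  = t x * (ι x * Q K (ι x))

  n/2≡k+L : n ℕ./ 2 ≡ k ℕ.+ L
  n/2≡k+L = trans (cong (ℕ._/ 2) (shape k)) (m*n/n≡m (k ℕ.+ L) 2)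
    where
    shape : ∀ k → 6 ℕ.* k ℕ.+ 4 ≡ (k ℕ.+ (2 ℕ.+ 2 ℕ.* k)) ℕ.* 2
    shape = solve-∀

  ι-n : ι n ≡ ι 6 * K + ι 4
  ι-n = trans (ι-+ (6 ℕ.* k) 4) (cong (_+ ι 4) (ι-* 6 k))

  tV[x+1]≡th[x] : ∀ x → x ℕ.< L → tV (suc x) ≡ th x
  tV[x+1]≡th[x] x x<L = begin
    t (suc x) * V K (ι (suc x))          ≡⟨ cong₂ (λ j y → JLterm n k j * V K y) (ℕ.+-suc k x) (ι-+ 1 x) ⟩
    JLterm n k (suc i) * V K (ι 1 + X)   ≡⟨ cong (JLterm n k (suc i) *_) (V-step K X) ⟩
    JLterm n k (suc i) * (A * B * U K X) ≡⟨ *-assoc (JLterm n k (suc i)) (A * B) (U K X) ⟨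
    JLterm n k (suc i) * (A * B) * U K X ≡⟨ cong (_* U K X) ratio ⟩
    t x * (C * D) * U K X                ≡⟨ *-assoc (t x) (C * D) (U K X) ⟩
    t x * (C * D * U K X)                ≡⟨ cong (t x *_) (h-step K X) ⟨
    t x * h K X                          ∎
    where
    i : ℕ
    i = k ℕ.+ x
    X N A B C D : ℚ
    X = ι x
    N = ι 6 * K + ι 4
    A = N - (K + X) - ι 1
    B = K + X + ι 1 - K
    C = N - ι 2 * (K + X)
    D = N - ι 2 * (K + X) - ι 1
    2[i+1]≤n : 2 ℕ.* suc i ℕ.≤ n
    2[i+1]≤n = ℕ.≤-trans (ℕ.*-monoʳ-≤ 2 (ℕ.s≤s (ℕ.+-monoʳ-≤ k (ℕ.s≤s⁻¹ x<L)))) (ℕ.≤-reflexive (shape k))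
      where
      shape : ∀ k → 2 ℕ.* suc (k ℕ.+ suc (2 ℕ.* k)) ≡ 6 ℕ.* k ℕ.+ 4
      shape = solve-∀
    ratio : JLterm n k (suc i) * (A * B) ≡ t x * (C * D)
    ratio = subst₂ (λ a b → JLterm n k (suc i) * ((a - b - ι 1) * (b + ι 1 - K)) ≡ t x * ((a - ι 2 * b) * (a - ι 2 * b - ι 1)))
                   ι-n (ι-+ k x) (JLterm-ratio n k i (ℕ.m≤m+n k x) 2[i+1]≤n)

  ∑th≡∑tV : ∑[ x ≤ L ] th (toℕ x) ≡ ∑[ x ≤ L ] tV (toℕ x)
  ∑th≡∑tV = ∑-shift L tV th
    (trans (cong (t 0 *_) (V-root K)) (*-zeroʳ (t 0)))
    (trans (cong (λ y → t L * h K y) ι-L) (trans (cong (t L *_) (h-root K)) (*-zeroʳ (t L))))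
    (λ x x<L → sym (tV[x+1]≡th[x] x x<L))
    where
    ι-L : ι L ≡ ι 2 + ι 2 * K
    ι-L = trans (ι-+ 2 (2 ℕ.* k)) (cong (ι 2 +_) (ι-* 2 k))

  [k+1]*Δ≡∑δ : ι (suc k) * Δ n k ≡ ∑[ x ≤ L ] δ (toℕ x)
  [k+1]*Δ≡∑δ = begin
    ι (suc k) * (JL n (suc k) - JL n k)
      ≡⟨ solve 3 (λ c a b → c :* (a :- b) := c :* a :- c :* b) refl (ι (suc k)) (JL n (suc k)) (JL n k) ⟩
    ι (suc k) * JL n (suc k) - ι (suc k) * JL n k
      ≡⟨ cong₂ _-_ ([k+1]*JL[k+1]≡∑ n k L n/2≡k+L) (cong (ι (suc k) *_) (JL≡∑ n k L n/2≡k+L)) ⟩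
    ∑[ x ≤ L ] (ι (toℕ x) * t (toℕ x)) - ι (suc k) * ∑[ x ≤ L ] t (toℕ x)
      ≡⟨ cong (λ s → ∑[ x ≤ L ] (ι (toℕ x) * t (toℕ x)) - s) (*-distribˡ-sum {suc L} (ι (suc k)) (λ x → t (toℕ x))) ⟩
    ∑[ x ≤ L ] (ι (toℕ x) * t (toℕ x)) - ∑[ x ≤ L ] (ι (suc k) * t (toℕ x))
      ≡⟨ ∑-distrib-- {suc L} (λ x → ι (toℕ x) * t (toℕ x)) (λ x → ι (suc k) * t (toℕ x)) ⟨
    ∑[ x ≤ L ] δ (toℕ x)
      ∎
    where open +-*-Solver

  M*δ≡w-[th-tV] : ∀ x → M K * δ x ≡ w x - (th x - tV x)
  M*δ≡w-[th-tV] x = begin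
    M K * (X * T - ι (suc k) * T)      ≡⟨ cong (λ c → M K * (X * T - c * T)) (ι-+ 1 k) ⟩
    M K * (X * T - (ι 1 + K) * T)      ≡⟨ solve 4 (λ m x t c → m :* (x :* t :- c :* t) := m :* (x :- c) :* t) refl (M K) X T (ι 1 + K) ⟩
    M K * (X - (ι 1 + K)) * T          ≡⟨ cong (_* T) (M-certificate K X) ⟩
    (X * Q K X - (h K X - V K X)) * T  ≡⟨ solve 5 (λ x q h v t → (x :* q :- (h :- v)) :* t := t :* (x :* q) :- (t :* h :- t :* v))
                                                  refl X (Q K X) (h K X) (V K X) T ⟩
    T * (X * Q K X) - (T * h K X - T * V K X) ∎
    where
    open +-*-Solver
    X T : ℚ
    X = ι x
    T = t x

  M*∑δ≡∑w : M K * ∑[ x ≤ L ] δ (toℕ x) ≡ ∑[ x ≤ L ] w (toℕ x)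
  M*∑δ≡∑w = begin
    M K * ∑[ x ≤ L ] δ (toℕ x)
      ≡⟨ *-distribˡ-sum {suc L} (M K) (λ x → δ (toℕ x)) ⟩
    ∑[ x ≤ L ] (M K * δ (toℕ x))
      ≡⟨ sum-cong-≗ {suc L} (λ x → M*δ≡w-[th-tV] (toℕ x)) ⟩
    ∑[ x ≤ L ] (w (toℕ x) - (th (toℕ x) - tV (toℕ x)))
      ≡⟨ ∑-distrib-- {suc L} (λ x → w (toℕ x)) (λ x → th (toℕ x) - tV (toℕ x)) ⟩
    ∑w - ∑[ x ≤ L ] (th (toℕ x) - tV (toℕ x))
      ≡⟨ cong (_-_ ∑w) (∑-distrib-- {suc L} (λ x → th (toℕ x)) (λ x → tV (toℕ x))) ⟩
    ∑w - (∑[ x ≤ L ] th (toℕ x) - ∑tV)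
      ≡⟨ cong (λ s → ∑w - (s - ∑tV)) ∑th≡∑tV ⟩
    ∑w - (∑tV - ∑tV)
      ≡⟨ solve 2 (λ a b → a :- (b :- b) := a) refl ∑w ∑tV ⟩
    ∑w
      ∎
    where
    open +-*-Solver
    ∑w ∑tV : ℚ
    ∑w  = ∑[ x ≤ L ] w (toℕ x)
    ∑tV = ∑[ x ≤ L ] tV (toℕ x)

  ∑w-pos : 0ℚ < ∑[ x ≤ L ] w (toℕ x)
  ∑w-pos = ∑-pos {L} (λ x → w (toℕ x))
    (λ x → *-nonNeg (JLterm-nonNeg n k (k ℕ.+ toℕ x)) (*-nonNeg (ι-nonNeg (toℕ x)) (<⇒≤ (Q-pos (ι-nonNeg k) (ι (toℕ x))))))
    (Fin.suc Fin.zero)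
    (*-pos (JLterm-pos (ℕ.m≤m+n k 1) 2[k+1]<n) (*-pos (ι-pos {1} ℕ.z<s) (Q-pos (ι-nonNeg k) (ι 1))))
    where
    2[k+1]<n : k ℕ.+ 1 ℕ.+ (k ℕ.+ 1) ℕ.< n
    2[k+1]<n = subst (suc (k ℕ.+ 1 ℕ.+ (k ℕ.+ 1)) ℕ.≤_) (shape k) (ℕ.m≤n+m (suc (k ℕ.+ 1 ℕ.+ (k ℕ.+ 1))) (4 ℕ.* k ℕ.+ 1))
      where
      shape : ∀ k → 4 ℕ.* k ℕ.+ 1 ℕ.+ suc (k ℕ.+ 1 ℕ.+ (k ℕ.+ 1)) ≡ 6 ℕ.* k ℕ.+ 4
      shape = solve-∀

  M*[k+1]*Δ≡∑w : M K * (ι (suc k) * Δ n k) ≡ ∑[ x ≤ L ] w (toℕ x)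
  M*[k+1]*Δ≡∑w = trans (cong (M K *_) [k+1]*Δ≡∑δ) M*∑δ≡∑w

open import Data.Nat using (suc; _+_; _*_; z<s)
open import Data.Rational using (0ℚ; _<_)
open import Relation.Binary.PropositionalEquality using (subst; sym)

lemma3p5 : ∀ (k : ℕ) → 0ℚ < Δ (6 * k + 4) k
lemma3p5 k =
  *-cancelˡ-pos (ι-pos {suc k} z<s) (*-cancelˡ-pos (M-pos (ι-nonNeg k)) (subst (0ℚ <_) (sym M*[k+1]*Δ≡∑w) ∑w-pos))
  where
  open Embedding
  open Order
  open Certificate
  open SixKPlusFour k
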